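{- A finite simple graph $G$ satisfies $\rho_1(G)=\rho_2(G)$ if and only if the simplicial cliques of $G$ partition $V(G)$.
   Context: For a graph $G$ and integer $k\ge1$, a $k$-packing is a set of vertices with pairwise distances larger than $k$, and $\rho_k(G)$ is the maximum size of a $k$-packing (so $\rho_1(G)$ is the independence number). A vertex $v$ is simplicial if its closed neighborhood $N_G[v]$ induces a complete subgraph. A simplicial clique is a (maximal) clique containing a simplicial vertex, i.e. a set $N_G[v]$ for a simplicial vertex $v$. -}

module Defs where

open import Data.Nat using (ℕ; zero; suc; _≤_)
open import Data.Fin using (Fin)
open import Data.Fin.Subset using (Subset; _∈_; ∣_∣)
open import Data.Bool using (Bool; true)
open import Data.Product using (Σ; ∃; ∃-syntax; _×_)
open import Data.Sum using (_⊎_)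
open import Relation.Nullary using (¬_)
open import Relation.Binary.PropositionalEquality using (_≡_; _≢_)

record Graph (n : ℕ) : Set where
  field
    adj   : Fin n → Fin n → Bool
    sym   : ∀ u v → adj u v ≡ adj v u
    irref : ∀ v → adj v v ≢ true

open Graph public

module _ {n : ℕ} (G : Graph n) where

  Adj : Fin n → Fin n → Set
  Adj u v = adj G u v ≡ true

  data Walk : Fin n → Fin n → ℕ → Set where
    here : ∀ {u} → Walk u u zero
    step : ∀ {u w v l} → Adj u w → Walk w v l → Walk u v (suc l)

  -- d_G(u,v) ≤ k  (distance is ∞ between different components)
  DistLe : ℕ → Fin n → Fin n → Set
  DistLe k u v = ∃[ l ] (l ≤ k × Walk u v l)

  IsPacking : ℕ → Subset n → Set
  IsPacking k S = ∀ u v → u ∈ S → v ∈ S → u ≢ v → ¬ DistLe k u v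

  IsRho : ℕ → ℕ → Set
  IsRho k m = (∃[ S ] (IsPacking k S × ∣ S ∣ ≡ m))
            × (∀ S → IsPacking k S → ∣ S ∣ ≤ m)

  InN : Fin n → Fin n → Set
  InN v x = x ≡ v ⊎ Adj v x

  Simplicial : Fin n → Set
  Simplicial v = ∀ x y → InN v x → InN v y → x ≢ y → Adj x y

  -- the simplicial cliques {N[v] : v simplicial} partition V(G):
  -- they cover V(G), and two of them that intersect are equal as sets
  SimplicialCliquesPartition : Set
  SimplicialCliquesPartition =
      (∀ x → ∃[ v ] (Simplicial v × InN v x))
    × (∀ v w x → Simplicial v → Simplicial w → InN v x → InN w x →
         ∀ y → (InN v y → InN w y) × (InN w y → InN v y))

-- Both conditions are equivalent to the existence of a perfect code of
-- simplicial vertices: a set S of simplicial vertices whose closed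
-- neighbourhoods partition V(G).  Such an S is a 2-packing, and an independent
-- set meets each clique N[s] at most once, so ρ₁ ≤ ∣S∣ ≤ ρ₂ ≤ ρ₁; moreover every
-- simplicial clique is one of the N[s].  Conversely, if ρ₁ = ρ₂ then a maximum
-- 2-packing is a maximum independent set, hence dominating, and an exchange
-- argument makes its vertices simplicial; and if the simplicial cliques
-- partition V(G), one simplicial vertex from each of them forms such an S.

module Submission where

open import Defs hiding (sym)
open import Data.Nat using (ℕ; suc; _≤_; _<_; s≤s; z≤n)
open import Data.Nat.Properties using (≤-trans; ≤-refl; ≤-reflexive; <-irrefl; ≤⇒≯; module ≤-Reasoning)
open import Data.Fin using (Fin; zero; suc) renaming (_<_ to _<ᶠ_)
open import Data.Fin.Properties using (_≟_; _<?_; <-cmp; any?; all?; 0≢1+n; suc-injective)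
open import Data.Fin.Induction using (<-wellFounded)
open import Data.Fin.Subset using (Subset; _∈_; _∉_; ∣_∣; _∪_; _─_; _-_; ⁅_⁆; inside; outside)
open import Data.Fin.Subset.Properties
  using (x∈p∪q⁻; x∈p∪q⁺; x∈⁅y⁆⇒x≡y; x∈⁅x⁆; x∉⁅y⁆⇒x≢y; p⊂q⇒∣p∣<∣q∣; p⊆p∪q; p─q⊆p; p─⊥≡p; x∈p∧x≢y⇒x∈p-y; _∈?_)
open import Data.Bool using (true)
open import Data.Bool.Properties using () renaming (_≟_ to _≟ᵇ_)
open import Data.Vec using (_∷_; []; tabulate; here; there)
open import Data.Vec.Properties using (lookup∘tabulate; []=⇒lookup; lookup⇒[]=)
open import Data.Product using (∃-syntax; _×_; _,_; proj₁; proj₂)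
open import Data.Sum using (_⊎_; inj₁; inj₂)
open import Function using (_∘_)
open import Function.Bundles using (_⇔_; mk⇔)
open import Induction.WellFounded using (Acc; acc)
open import Relation.Nullary using (¬_; Dec; yes; no; does; ¬?; _×-dec_; _⊎-dec_; _→-dec_; contradiction)
open import Relation.Nullary.Decidable using (dec-true; decidable-stable)
open import Relation.Unary using (Pred; Decidable)
open import Relation.Binary.Definitions using (tri<; tri≈; tri>)
open import Relation.Binary.PropositionalEquality using (_≡_; _≢_; refl; sym; trans; cong; subst)

private
  variable
    m n : ℕ

module _ {ℓ} {P : Pred (Fin n) ℓ} (P? : Decidable P) where

  subsetOf : Subset n
  subsetOf = tabulate (does ∘ P?)

  ∈-subsetOf⁺ : ∀ {x} → P x → x ∈ subsetOf
  ∈-subsetOf⁺ {x} px = lookup⇒[]= x subsetOf (trans (lookup∘tabulate _ x) (dec-true (P? x) px))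

  ∈-subsetOf⁻ : ∀ {x} → x ∈ subsetOf → P x
  ∈-subsetOf⁻ {x} x∈ with P? x | trans (sym (lookup∘tabulate (does ∘ P?) x)) ([]=⇒lookup x∈)
  ... | yes px | _ = px
  ... | no  _  | ()

x∈p─q⇒x∉q : ∀ (p q : Subset n) {x} → x ∈ p ─ q → x ∉ q
x∈p─q⇒x∉q (inside  ∷ p) (inside ∷ q) () here
x∈p─q⇒x∉q (outside ∷ p) (inside ∷ q) () here
x∈p─q⇒x∉q (_ ∷ p) (_ ∷ q) (there x∈p─q) (there x∈q) = x∈p─q⇒x∉q p q x∈p─q x∈q

x∈p-y⇒x≢y : ∀ {p : Subset n} {x y} → x ∈ p - y → x ≢ y
x∈p-y⇒x≢y {p = p} {y = y} x∈ = x∉⁅y⁆⇒x≢y (x∈p─q⇒x∉q p ⁅ y ⁆ x∈)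

x∈p-y⇒x∈p : ∀ {p : Subset n} {x y} → x ∈ p - y → x ∈ p
x∈p-y⇒x∈p {p = p} {y = y} = p─q⊆p p ⁅ y ⁆

x∈p∪⁅y⁆⁻ : ∀ {p : Subset n} {x y} → x ∈ p ∪ ⁅ y ⁆ → x ∈ p ⊎ x ≡ y
x∈p∪⁅y⁆⁻ {p = p} {y = y} x∈ with x∈p∪q⁻ p ⁅ y ⁆ x∈
... | inj₁ x∈p = inj₁ x∈p
... | inj₂ x∈y = inj₂ (x∈⁅y⁆⇒x≡y y x∈y)

x∈p⇒∣p∣≡1+∣p-x∣ : ∀ {p : Subset n} {x} → x ∈ p → ∣ p ∣ ≡ suc ∣ p - x ∣
x∈p⇒∣p∣≡1+∣p-x∣ {p = inside ∷ p} here = cong suc (sym (cong ∣_∣ (p─⊥≡p p)))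
x∈p⇒∣p∣≡1+∣p-x∣ {p = inside  ∷ p} (there x∈p) = cong suc (x∈p⇒∣p∣≡1+∣p-x∣ x∈p)
x∈p⇒∣p∣≡1+∣p-x∣ {p = outside ∷ p} (there x∈p) = x∈p⇒∣p∣≡1+∣p-x∣ x∈p

x∉p⇒∣p∣<∣p∪⁅x⁆∣ : ∀ {p : Subset n} {x} → x ∉ p → ∣ p ∣ < ∣ p ∪ ⁅ x ⁆ ∣
x∉p⇒∣p∣<∣p∪⁅x⁆∣ {p = p} {x} x∉p =
  p⊂q⇒∣p∣<∣q∣ (p⊆p∪q ⁅ x ⁆ , x , x∈p∪q⁺ (inj₂ (x∈⁅x⁆ x)) , x∉p)

injectiveOn⇒∣p∣≤∣q∣ : ∀ (p : Subset m) (q : Subset n) (f : Fin m → Fin n) →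
                      (∀ {x} → x ∈ p → f x ∈ q) →
                      (∀ {x y} → x ∈ p → y ∈ p → f x ≡ f y → x ≡ y) →
                      ∣ p ∣ ≤ ∣ q ∣
injectiveOn⇒∣p∣≤∣q∣ [] q f _ _ = z≤n
injectiveOn⇒∣p∣≤∣q∣ (outside ∷ p) q f into inj =
  injectiveOn⇒∣p∣≤∣q∣ p q (f ∘ suc) (into ∘ there) (λ x∈ y∈ → suc-injective ∘ inj (there x∈) (there y∈))
injectiveOn⇒∣p∣≤∣q∣ (inside ∷ p) q f into inj = begin
  suc ∣ p ∣          ≤⟨ s≤s (injectiveOn⇒∣p∣≤∣q∣ p (q - f zero) (f ∘ suc) into′ inj′) ⟩
  suc ∣ q - f zero ∣ ≡⟨ sym (x∈p⇒∣p∣≡1+∣p-x∣ (into here)) ⟩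
  ∣ q ∣              ∎
  where
  open ≤-Reasoning
  into′ : ∀ {x} → x ∈ p → f (suc x) ∈ q - f zero
  into′ x∈p = x∈p∧x≢y⇒x∈p-y (into (there x∈p)) (0≢1+n ∘ inj here (there x∈p) ∘ sym)
  inj′ : ∀ {x y} → x ∈ p → y ∈ p → f (suc x) ≡ f (suc y) → x ≡ y
  inj′ x∈ y∈ = suc-injective ∘ inj (there x∈) (there y∈)

leastWitness : ∀ {ℓ} {P : Pred (Fin n) ℓ} → Decidable P → ∀ {x} → P x →
               ∃[ w ] (P w × (∀ {v} → v <ᶠ w → ¬ P v))
leastWitness {P = P} P? {x} px = search x (<-wellFounded x) px
  where
  search : ∀ x → Acc _<ᶠ_ x → P x → ∃[ w ] (P w × (∀ {v} → v <ᶠ w → ¬ P v))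
  search x (acc rec) px with any? (λ v → (v <? x) ×-dec P? v)
  ... | yes (v , v<x , pv) = search v (rec v<x) pv
  ... | no  ∄v             = x , px , λ v<x pv → ∄v (_ , v<x , pv)

module _ (G : Graph n) where

  private
    variable
      u v w x y z s t : Fin n
      S T : Subset n

  Adj? : ∀ u v → Dec (Adj G u v)
  Adj? u v = adj G u v ≟ᵇ true

  Adj-sym : Adj G u v → Adj G v u
  Adj-sym {u} {v} = trans (Graph.sym G v u)

  Adj⇒≢ : Adj G u v → u ≢ v
  Adj⇒≢ {u} a refl = irref G u a

  InN? : ∀ v x → Dec (InN G v x)
  InN? v x = (x ≟ v) ⊎-dec Adj? v x

  InN-refl : InN G v v
  InN-refl = inj₁ refl

  InN-sym : InN G u v → InN G v u
  InN-sym (inj₁ refl) = inj₁ refl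
  InN-sym (inj₂ a)    = inj₂ (Adj-sym a)

  Simplicial? : ∀ v → Dec (Simplicial G v)
  Simplicial? v = all? λ x → all? λ y →
    InN? v x →-dec InN? v y →-dec ¬? (x ≟ y) →-dec Adj? x y

  neighbours-adjacent⇒simplicial : (∀ {x y} → Adj G v x → Adj G v y → x ≢ y → Adj G x y) →
                                   Simplicial G v
  neighbours-adjacent⇒simplicial _ x y (inj₁ refl) (inj₁ refl) x≢y = contradiction refl x≢y
  neighbours-adjacent⇒simplicial _ x y (inj₁ refl) (inj₂ vy)   _   = vy
  neighbours-adjacent⇒simplicial _ x y (inj₂ vx)   (inj₁ refl) _   = Adj-sym vx
  neighbours-adjacent⇒simplicial h x y (inj₂ vx)   (inj₂ vy)   x≢y = h vx vy x≢y

  simplicial-N⊆N : Simplicial G v → InN G v w → InN G v y → InN G w y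
  simplicial-N⊆N {w = w} {y} simp vw vy with w ≟ y
  ... | yes refl = InN-refl
  ... | no  w≢y  = inj₂ (simp w y vw vy w≢y)

  DistLe-1⇒InN : DistLe G 1 u v → InN G u v
  DistLe-1⇒InN (_ , _      , here)           = inj₁ refl
  DistLe-1⇒InN (_ , _      , step a here)    = inj₂ a
  DistLe-1⇒InN (_ , s≤s () , step _ (step _ _))

  Adj⇒DistLe-1 : Adj G u v → DistLe G 1 u v
  Adj⇒DistLe-1 a = 1 , ≤-refl , step a here

  DistLe-2⇒N∩N : DistLe G 2 u v → ∃[ z ] (InN G u z × InN G v z)
  DistLe-2⇒N∩N (_ , _ , here)                 = _ , InN-refl , InN-refl
  DistLe-2⇒N∩N (_ , _ , step a here)          = _ , inj₂ a , InN-refl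
  DistLe-2⇒N∩N (_ , _ , step a (step b here)) = _ , inj₂ a , inj₂ (Adj-sym b)
  DistLe-2⇒N∩N (_ , s≤s (s≤s ()) , step _ (step _ (step _ _)))

  N∩N⇒DistLe-2 : InN G u z → InN G v z → DistLe G 2 u v
  N∩N⇒DistLe-2 (inj₁ refl) (inj₁ refl) = 0 , z≤n , here
  N∩N⇒DistLe-2 (inj₁ refl) (inj₂ vz)    = 1 , s≤s z≤n , step (Adj-sym vz) here
  N∩N⇒DistLe-2 (inj₂ uz)   (inj₁ refl)  = 1 , s≤s z≤n , step uz here
  N∩N⇒DistLe-2 (inj₂ uz)   (inj₂ vz)    = 2 , ≤-refl , step uz (step (Adj-sym vz) here)

  IsPacking-antimono : ∀ {k l} → k ≤ l → IsPacking G l S → IsPacking G k S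
  IsPacking-antimono k≤l pack u v u∈ v∈ u≢v (j , j≤k , walk) =
    pack u v u∈ v∈ u≢v (j , ≤-trans j≤k k≤l , walk)

  Independent : Subset n → Set
  Independent S = ∀ {u v} → u ∈ S → v ∈ S → ¬ Adj G u v

  DisjointNeighbourhoods : Subset n → Set
  DisjointNeighbourhoods S = ∀ {s t x} → s ∈ S → t ∈ S → InN G s x → InN G t x → s ≡ t

  packing₁⇒independent : IsPacking G 1 S → Independent S
  packing₁⇒independent pack u∈ v∈ a = pack _ _ u∈ v∈ (Adj⇒≢ a) (Adj⇒DistLe-1 a)

  independent⇒packing₁ : Independent S → IsPacking G 1 S
  independent⇒packing₁ indep u v u∈ v∈ u≢v d with DistLe-1⇒InN d
  ... | inj₁ refl = u≢v refl
  ... | inj₂ a    = indep u∈ v∈ a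

  packing₂⇒disjoint : IsPacking G 2 S → DisjointNeighbourhoods S
  packing₂⇒disjoint pack {s} {t} s∈ t∈ sx tx with s ≟ t
  ... | yes s≡t = s≡t
  ... | no  s≢t = contradiction (N∩N⇒DistLe-2 sx tx) (pack s t s∈ t∈ s≢t)

  disjoint⇒packing₂ : DisjointNeighbourhoods S → IsPacking G 2 S
  disjoint⇒packing₂ disj u v u∈ v∈ u≢v d =
    let (_ , uz , vz) = DistLe-2⇒N∩N d in u≢v (disj u∈ v∈ uz vz)

  disjoint⇒independent : DisjointNeighbourhoods S → Independent S
  disjoint⇒independent disj u∈ v∈ a = Adj⇒≢ a (disj u∈ v∈ (inj₂ a) InN-refl)

  independent-∪-⁅⁆ : Independent T → (∀ {t} → t ∈ T → ¬ Adj G t z) → Independent (T ∪ ⁅ z ⁆)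
  independent-∪-⁅⁆ {z = z} indep z-free u∈ v∈ a with x∈p∪⁅y⁆⁻ u∈ | x∈p∪⁅y⁆⁻ v∈
  ... | inj₁ u∈T  | inj₁ v∈T  = indep u∈T v∈T a
  ... | inj₁ u∈T  | inj₂ refl = z-free u∈T a
  ... | inj₂ refl | inj₁ v∈T  = z-free v∈T (Adj-sym a)
  ... | inj₂ refl | inj₂ refl = irref G z a

  extension⇒∣T∣<∣S∣ : (∀ {T} → Independent T → ∣ T ∣ ≤ ∣ S ∣) →
                      Independent T → z ∉ T → (∀ {t} → t ∈ T → ¬ Adj G t z) → ∣ T ∣ < ∣ S ∣
  extension⇒∣T∣<∣S∣ α≤∣S∣ indep z∉T z-free =
    ≤-trans (x∉p⇒∣p∣<∣p∪⁅x⁆∣ z∉T) (α≤∣S∣ (independent-∪-⁅⁆ indep z-free))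

  maximum-independent⇒dominating : (∀ {T} → Independent T → ∣ T ∣ ≤ ∣ S ∣) → Independent S →
                                   ∀ x → ∃[ s ] (s ∈ S × InN G s x)
  maximum-independent⇒dominating {S} α≤∣S∣ indep x with any? (λ s → (s ∈? S) ×-dec InN? s x)
  ... | yes dominated = dominated
  ... | no  ∄s        = contradiction ∣S∣<∣S∣ (<-irrefl refl)
    where
    ∣S∣<∣S∣ : ∣ S ∣ < ∣ S ∣
    ∣S∣<∣S∣ = extension⇒∣T∣<∣S∣ {S = S} α≤∣S∣ indep
                (λ x∈S → ∄s (x , x∈S , InN-refl)) (λ t∈S tx → ∄s (_ , t∈S , inj₂ tx))

  -- Exchange argument: if two neighbours x, y of s ∈ S were non-adjacent,
  -- (S - s) ∪ {x, y} would be an independent set larger than S.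
  maximum-independent-disjoint⇒simplicial : (∀ {T} → Independent T → ∣ T ∣ ≤ ∣ S ∣) →
                                            DisjointNeighbourhoods S → s ∈ S → Simplicial G s
  maximum-independent-disjoint⇒simplicial {S} {s} α≤∣S∣ disj s∈S =
    neighbours-adjacent⇒simplicial adjacent
    where
    S′ : Subset n
    S′ = S - s

    outside-S′ : InN G s z → t ∈ S′ → ¬ InN G t z
    outside-S′ sz t∈S′ tz = x∈p-y⇒x≢y t∈S′ (disj (x∈p-y⇒x∈p t∈S′) s∈S tz sz)

    independent-S′ : Independent S′
    independent-S′ u∈ v∈ = disjoint⇒independent disj (x∈p-y⇒x∈p u∈) (x∈p-y⇒x∈p v∈)

    adjacent : Adj G s x → Adj G s y → x ≢ y → Adj G x y
    adjacent {x} {y} sx sy x≢y = decidable-stable (Adj? x y) λ ¬xy →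
      ≤⇒≯ ∣S∣≤∣S″∣ (extension⇒∣T∣<∣S∣ {S = S} α≤∣S∣ independent-S″ y∉S″ (y-free ¬xy))
      where
      S″ : Subset n
      S″ = S′ ∪ ⁅ x ⁆

      x∉S′ : x ∉ S′
      x∉S′ x∈S′ = outside-S′ (inj₂ sx) x∈S′ InN-refl

      ∣S∣≤∣S″∣ : ∣ S ∣ ≤ ∣ S″ ∣
      ∣S∣≤∣S″∣ = ≤-trans (≤-reflexive (x∈p⇒∣p∣≡1+∣p-x∣ s∈S)) (x∉p⇒∣p∣<∣p∪⁅x⁆∣ x∉S′)

      independent-S″ : Independent S″
      independent-S″ = independent-∪-⁅⁆ independent-S′ λ t∈S′ tx → outside-S′ (inj₂ sx) t∈S′ (inj₂ tx)

      y∉S″ : y ∉ S″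
      y∉S″ y∈S″ with x∈p∪⁅y⁆⁻ y∈S″
      ... | inj₁ y∈S′ = outside-S′ (inj₂ sy) y∈S′ InN-refl
      ... | inj₂ y≡x  = x≢y (sym y≡x)

      y-free : ¬ Adj G x y → ∀ {t} → t ∈ S″ → ¬ Adj G t y
      y-free ¬xy t∈S″ ty with x∈p∪⁅y⁆⁻ t∈S″
      ... | inj₁ t∈S′ = outside-S′ (inj₂ sy) t∈S′ (inj₂ ty)
      ... | inj₂ refl = ¬xy ty

  record SimplicialPerfectCode (S : Subset n) : Set where
    field
      simplicial : ∀ {s} → s ∈ S → Simplicial G s
      disjoint   : DisjointNeighbourhoods S
      dominating : ∀ x → ∃[ s ] (s ∈ S × InN G s x)

  equal-ρ⇒code : ∀ {m} → IsRho G 1 m → IsRho G 2 m → ∃[ S ] SimplicialPerfectCode S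
  equal-ρ⇒code (_ , α≤m) ((S , pack , ∣S∣≡m) , _) = S , record
    { simplicial = maximum-independent-disjoint⇒simplicial α≤∣S∣ disj
    ; disjoint   = disj
    ; dominating = maximum-independent⇒dominating α≤∣S∣ (disjoint⇒independent disj)
    }
    where
    disj : DisjointNeighbourhoods S
    disj = packing₂⇒disjoint pack

    α≤∣S∣ : ∀ {T} → Independent T → ∣ T ∣ ≤ ∣ S ∣
    α≤∣S∣ indep = subst (_ ≤_) (sym ∣S∣≡m) (α≤m _ (independent⇒packing₁ indep))

  code⇒ρ : SimplicialPerfectCode S → IsRho G 1 ∣ S ∣ × IsRho G 2 ∣ S ∣
  code⇒ρ {S} code =
      ((S , packing₁ , refl) , λ T → α≤∣S∣ ∘ packing₁⇒independent)
    , ((S , packing₂ , refl) , λ T → α≤∣S∣ ∘ packing₁⇒independent ∘ IsPacking-antimono 1≤2)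
    where
    open SimplicialPerfectCode code

    1≤2 : 1 ≤ 2
    1≤2 = s≤s z≤n

    packing₂ : IsPacking G 2 S
    packing₂ = disjoint⇒packing₂ disjoint

    packing₁ : IsPacking G 1 S
    packing₁ = IsPacking-antimono 1≤2 packing₂

    centre : Fin n → Fin n
    centre x = proj₁ (dominating x)

    -- An independent set meets each simplicial clique at most once.
    α≤∣S∣ : Independent T → ∣ T ∣ ≤ ∣ S ∣
    α≤∣S∣ {T} indep = injectiveOn⇒∣p∣≤∣q∣ T S centre (λ {x} _ → proj₁ (proj₂ (dominating x))) injective
      where
      injective : x ∈ T → y ∈ T → centre x ≡ centre y → x ≡ y
      injective {x} {y} x∈T y∈T eq = decidable-stable (x ≟ y) λ x≢y →
        let (c∈S , cx) = proj₂ (dominating x)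
            cy         = subst (λ c → InN G c y) (sym eq) (proj₂ (proj₂ (dominating y)))
        in indep x∈T y∈T (simplicial c∈S x y cx cy x≢y)

  code⇒partition : SimplicialPerfectCode S → SimplicialCliquesPartition G
  code⇒partition code =
      (λ x → let (s , s∈S , sx) = dominating x in s , simplicial s∈S , sx)
    , λ v w x sv sw vx wx y → N⊆N sv sw vx wx , N⊆N sw sv wx vx
    where
    open SimplicialPerfectCode code

    N⊆N : Simplicial G v → Simplicial G w → InN G v x → InN G w x → InN G v y → InN G w y
    N⊆N {v} {w} {y = y} sv sw vx wx vy =
      let (s , s∈S , sv′) = dominating v
          (t , t∈S , tw)  = dominating w
          s≡t = disjoint s∈S t∈S (simplicial-N⊆N sv (InN-sym sv′) vx)
                                 (simplicial-N⊆N sw (InN-sym tw) wx)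
      in simplicial-N⊆N (simplicial t∈S) tw
           (subst (λ c → InN G c y) s≡t (simplicial-N⊆N sv (InN-sym sv′) vy))

  -- Each simplicial clique is represented by its least simplicial vertex.
  partition⇒code : SimplicialCliquesPartition G → ∃[ S ] SimplicialPerfectCode S
  partition⇒code (covered , cliques-agree) = representatives , record
    { simplicial = proj₁ ∘ ∈-subsetOf⁻ Representative?
    ; disjoint   = disjoint
    ; dominating = dominating
    }
    where
    N⊆N : Simplicial G v → Simplicial G w → InN G v x → InN G w x → InN G v y → InN G w y
    N⊆N {v} {w} {x} {y} sv sw vx wx = proj₁ (cliques-agree v w x sv sw vx wx y)

    Representative : Fin n → Set
    Representative v = Simplicial G v × (∀ w → w <ᶠ v → ¬ (Simplicial G w × InN G w v))

    Representative? : ∀ v → Dec (Representative v)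
    Representative? v = Simplicial? v ×-dec all? λ w → w <? v →-dec ¬? (Simplicial? w ×-dec InN? w v)

    representatives : Subset n
    representatives = subsetOf Representative?

    disjoint : DisjointNeighbourhoods representatives
    disjoint {s} {t} s∈ t∈ sx tx
      with ∈-subsetOf⁻ Representative? s∈ | ∈-subsetOf⁻ Representative? t∈ | <-cmp s t
    ... | ss , _       | st , t-least | tri< s<t _ _ = contradiction (ss , N⊆N st ss tx sx InN-refl) (t-least s s<t)
    ... | _            | _            | tri≈ _ s≡t _ = s≡t
    ... | ss , s-least | st , _       | tri> _ _ t<s = contradiction (st , N⊆N ss st sx tx InN-refl) (s-least t t<s)

    dominating : ∀ x → ∃[ s ] (s ∈ representatives × InN G s x)
    dominating x =
      let (v , sv , vx) = covered x
          (w , (sw , wv) , least) = leastWitness (λ w → Simplicial? w ×-dec InN? w v) (sv , InN-refl)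
          w-least u u<w (su , uw) = least u<w (su , N⊆N sw su InN-refl uw wv)
      in w , ∈-subsetOf⁺ Representative? (sw , w-least) , N⊆N sv sw InN-refl wv vx

theorem4 : ∀ {n : ℕ} (G : Graph n) →
    (∃[ m ] (IsRho G 1 m × IsRho G 2 m)) ⇔ SimplicialCliquesPartition G
theorem4 G = mk⇔
  (λ (_ , ρ₁ , ρ₂) → code⇒partition G (proj₂ (equal-ρ⇒code G ρ₁ ρ₂)))
  (λ partition → let (S , code) = partition⇒code G partition in ∣ S ∣ , code⇒ρ G code)
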